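{- Let $f$ be a first kind semi-arithmetic IASI of a graph $G$ and let $v_i$ and $v_j$ be two adjacent vertices of $G$. Then all the compatibility classes in $f(v_i)\times f(v_j)$ are trivial classes.
   Context: All graphs are simple, finite, without isolated vertices; all sets are finite subsets of the non-negative integers $\mathbb{N}_0$. For $A,B\subseteq\mathbb{N}_0$, $A+B=\{a+b: a\in A, b\in B\}$. An integer additive set-indexer (IASI) of $G$ is an injective function $f:V(G)\to 2^{\mathbb{N}_0}$ such that $f^{+}(uv)=f(u)+f(v)$ defines an injective map on $E(G)$. An AP-set is a set whose elements are in arithmetic progression (with at least three elements); its common difference is the deterministic index of the element it labels. An IASI is vertex-arithmetic if every vertex label is an AP-set. A first kind semi-arithmetic IASI is a vertex-arithmetic IASI $f$ such that for adjacent vertices $v_i,v_j$ with deterministic indices $d_i,d_j$, $d_j=k d_i$ for a non-negative integer $k>|f(v_i)|$. For sets $A,B$, two pairs $(a,b),(c,d)\in A\times B$ are compatible if $a+b=c+d$; the compatibility class of $(a,b)$ is the set of all pairs in $A\times B$ compatible with it, and it is trivial if it consists of $(a,b)$ alone. -}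

module Defs where

open import Data.Nat using (ℕ; _+_; _*_; _≤_; _<_)
open import Data.Fin using (Fin)
open import Data.List using (List; length)
open import Data.List.Membership.Propositional using (_∈_)
open import Data.List.Relation.Unary.Unique.Propositional using (Unique)
open import Data.Product using (Σ; ∃; ∃-syntax; _×_; _,_; proj₁)
open import Data.Sum using (_⊎_)
open import Relation.Binary.PropositionalEquality using (_≡_)
open import Relation.Nullary using (¬_)
open import Function.Bundles using (_⇔_)

FinSet : Set
FinSet = Σ (List ℕ) Unique

elems : FinSet → List ℕ
elems = proj₁

_∈ˢ_ : ℕ → FinSet → Set
x ∈ˢ A = x ∈ elems A

∣_∣ˢ : FinSet → ℕ
∣ A ∣ˢ = length (elems A)

_≈ˢ_ : FinSet → FinSet → Set
A ≈ˢ B = ∀ x → (x ∈ˢ A) ⇔ (x ∈ˢ B)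

_∈+_,_ : ℕ → FinSet → FinSet → Set
x ∈+ A , B = ∃[ a ] ∃[ b ] (a ∈ˢ A × b ∈ˢ B × x ≡ a + b)

SumEq : FinSet → FinSet → FinSet → FinSet → Set
SumEq A B C D = ∀ x → (x ∈+ A , B) ⇔ (x ∈+ C , D)

record Graph (n : ℕ) : Set₁ where
  field
    Adj      : Fin n → Fin n → Set
    sym      : ∀ {u v} → Adj u v → Adj v u
    irrefl   : ∀ {u} → ¬ Adj u u
    noIsol   : ∀ u → ∃[ v ] Adj u v
open Graph public

record IsIASI {n : ℕ} (G : Graph n) (f : Fin n → FinSet) : Set where
  field
    vinj : ∀ u v → f u ≈ˢ f v → u ≡ v
    einj : ∀ u v u' v' → Adj G u v → Adj G u' v' →
           SumEq (f u) (f v) (f u') (f v') →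
           (u ≡ u' × v ≡ v') ⊎ (u ≡ v' × v ≡ u')

IsAPSet : FinSet → ℕ → Set
IsAPSet A d = ∃[ a ] ∃[ m ] (3 ≤ m × 1 ≤ d ×
                (∀ x → (x ∈ˢ A) ⇔ (∃[ i ] (i < m × x ≡ a + i * d))))

VertexArithmetic : ∀ {n} → Graph n → (Fin n → FinSet) → Set
VertexArithmetic {n} G f = IsIASI G f × (∀ v → ∃[ d ] IsAPSet (f v) d)

SemiCond : FinSet → FinSet → Set
SemiCond Ai Aj = ∃[ di ] ∃[ dj ] (IsAPSet Ai di × IsAPSet Aj dj ×
                   ∃[ k ] (∣ Ai ∣ˢ < k × dj ≡ k * di))

-- First kind semi-arithmetic IASI: for each pair of adjacent vertices,
-- with a suitable labelling v_i, v_j of the two ends, d_j = k d_i, k > |f(v_i)|.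
FirstKindSemiArith : ∀ {n} → Graph n → (Fin n → FinSet) → Set
FirstKindSemiArith {n} G f =
  VertexArithmetic G f ×
  (∀ u v → Adj G u v → SemiCond (f u) (f v) ⊎ SemiCond (f v) (f u))

_∈×_,_ : ℕ × ℕ → FinSet → FinSet → Set
(a , b) ∈× A , B = a ∈ˢ A × b ∈ˢ B

InClass : FinSet → FinSet → ℕ × ℕ → ℕ × ℕ → Set
InClass A B (a , b) (c , d) = (c , d) ∈× A , B × a + b ≡ c + d

TrivialClass : FinSet → FinSet → ℕ × ℕ → Set
TrivialClass A B p = ∀ q → InClass A B p q → q ≡ p

AllClassesTrivial : FinSet → FinSet → Set
AllClassesTrivial A B = ∀ p → p ∈× A , B → TrivialClass A B p

-- Write f(v_i) = {a + i d : i < m} and f(v_j) = {b + j k d : j < m'}.  Then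
-- (a + i d) + (b + j k d) = (a + b) + (i + j k) d, and since i < m ≤ |f(v_i)| < k,
-- the number i + j k determines i and j (they are its digits in "base k").
-- Hence the sum of a pair determines the pair: every compatibility class is trivial.
module Submission where

open import Defs hiding (sym)
open import Data.Nat using (ℕ; _+_; _*_; _≤_; _<_; NonZero; >-nonZero; _≤?_; z≤n)
open import Data.Nat.Properties
open import Data.Nat.DivMod using (_%_; [m+kn]%n≡m%n; m<n⇒m%n≡m)
open import Data.Fin using (Fin; toℕ)
open import Data.Fin.Properties using (pigeonhole; toℕ<n)
open import Data.List using (List; length; lookup)
open import Data.List.Membership.Propositional using (_∈_)
open import Data.List.Relation.Unary.Any using (index)
open import Data.List.Relation.Unary.Any.Properties using (lookup-index)
open import Data.Product using (_×_; _,_; proj₁; proj₂)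
open import Data.Sum using (_⊎_; inj₁; inj₂)
open import Relation.Binary.PropositionalEquality
open import Relation.Nullary using (yes; no; contradiction)
open import Function.Bundles using (Equivalence)
open import Data.Nat.Tactic.RingSolver using (solve-∀)

open Equivalence using (to; from)

injective-family-≤-length : ∀ {A : Set} (xs : List A) (g : ℕ → A) (m : ℕ) →
                            (∀ {i j} → g i ≡ g j → i ≡ j) →
                            (∀ {i} → i < m → g i ∈ xs) → m ≤ length xs
injective-family-≤-length xs g m g-inj g∈xs with m ≤? length xs
... | yes m≤len = m≤len
... | no m≰len with pigeonhole (≰⇒> m≰len) (λ i → index (g∈xs (toℕ<n i)))
...   | i , j , i<j , same-index = contradiction (g-inj g-i≡g-j) (<⇒≢ i<j)
  where
  g-i≡g-j : g (toℕ i) ≡ g (toℕ j)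
  g-i≡g-j = trans (lookup-index (g∈xs (toℕ<n i)))
                  (trans (cong (lookup xs) same-index) (sym (lookup-index (g∈xs (toℕ<n j)))))

apTerm-injective : ∀ a d .{{_ : NonZero d}} {i j} → a + i * d ≡ a + j * d → i ≡ j
apTerm-injective a d {i} {j} eq = *-cancelʳ-≡ i j d (+-cancelˡ-≡ a _ _ eq)

m+n*k-injective : ∀ {i j i' j'} k .{{_ : NonZero k}} → i < k → i' < k →
                  i + j * k ≡ i' + j' * k → i ≡ i' × j ≡ j'
m+n*k-injective {i} {j} {i'} {j'} k i<k i'<k eq = i≡i' , apTerm-injective i k j*k-eq
  where
  open ≡-Reasoning
  i≡i' : i ≡ i'
  i≡i' = begin
    i                 ≡⟨ m<n⇒m%n≡m i<k ⟨
    i % k             ≡⟨ [m+kn]%n≡m%n i j k ⟨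
    (i + j * k) % k   ≡⟨ cong (_% k) eq ⟩
    (i' + j' * k) % k ≡⟨ [m+kn]%n≡m%n i' j' k ⟩
    i' % k            ≡⟨ m<n⇒m%n≡m i'<k ⟩
    i'                ∎
  j*k-eq : i + j * k ≡ i + j' * k
  j*k-eq = trans eq (cong (_+ j' * k) (sym i≡i'))

regroup : ∀ a b i j k d → (a + i * d) + (b + j * (k * d)) ≡ (a + b) + (i + j * k) * d
regroup = solve-∀

SumInjective : FinSet → FinSet → Set
SumInjective A B = ∀ {x y x' y'} → x ∈ˢ A → y ∈ˢ B → x' ∈ˢ A → y' ∈ˢ B →
                   x + y ≡ x' + y' → x ≡ x' × y ≡ y'

SemiCond⇒SumInjective : ∀ A B → SemiCond A B → SumInjective A B
SemiCond⇒SumInjective A B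
  (d , dj , (a , m , _ , 1≤d , A-ap) , (b , _ , _ , _ , B-ap) , k , |A|<k , dj≡k*d)
  x∈A y∈B x'∈A y'∈B eq
  with to (A-ap _) x∈A | to (B-ap _) y∈B | to (A-ap _) x'∈A | to (B-ap _) y'∈B
... | i , i<m , refl | j , _ , refl | i' , i'<m , refl | j' , _ , refl =
  cong (λ t → a + t * d) (proj₁ digits) , cong (λ t → b + t * dj) (proj₂ digits)
  where
  instance
    d≢0 : NonZero d
    d≢0 = >-nonZero 1≤d
    k≢0 : NonZero k
    k≢0 = >-nonZero (≤-<-trans z≤n |A|<k)

  m<k : m < k
  m<k = ≤-<-trans (injective-family-≤-length (elems A) (λ t → a + t * d) m
                     (apTerm-injective a d) (λ {t} t<m → from (A-ap _) (t , t<m , refl)))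
                  |A|<k

  combined : (a + b) + (i + j * k) * d ≡ (a + b) + (i' + j' * k) * d
  combined = begin
    (a + b) + (i + j * k) * d          ≡⟨ regroup a b i j k d ⟨
    (a + i * d) + (b + j * (k * d))    ≡⟨ subst (λ e → (a + i * d) + (b + j * e) ≡ (a + i' * d) + (b + j' * e)) dj≡k*d eq ⟩
    (a + i' * d) + (b + j' * (k * d))  ≡⟨ regroup a b i' j' k d ⟩
    (a + b) + (i' + j' * k) * d        ∎
    where open ≡-Reasoning

  digits : i ≡ i' × j ≡ j'
  digits = m+n*k-injective k (<-trans i<m m<k) (<-trans i'<m m<k)
                           (apTerm-injective (a + b) d combined)

SumInjective-swap : ∀ A B → SumInjective A B → SumInjective B A
SumInjective-swap A B inj {y} {x} {y'} {x'} y∈B x∈A y'∈B x'∈A eq =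
  let x≡x' , y≡y' = inj x∈A y∈B x'∈A y'∈B (trans (+-comm x y) (trans eq (+-comm y' x')))
  in y≡y' , x≡x'

either-SemiCond⇒SumInjective : ∀ A B → SemiCond A B ⊎ SemiCond B A → SumInjective A B
either-SemiCond⇒SumInjective A B (inj₁ cond) = SemiCond⇒SumInjective A B cond
either-SemiCond⇒SumInjective A B (inj₂ cond) =
  SumInjective-swap B A (SemiCond⇒SumInjective B A cond)

SumInjective⇒AllClassesTrivial : ∀ A B → SumInjective A B → AllClassesTrivial A B
SumInjective⇒AllClassesTrivial A B inj (x , y) (x∈A , y∈B) (x' , y') ((x'∈A , y'∈B) , eq) =
  let x'≡x , y'≡y = inj x'∈A y'∈B x∈A y∈B (sym eq) in cong₂ _,_ x'≡x y'≡y

mainTheorem2 : (n : ℕ) (G : Graph n) (f : Fin n → FinSet) →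
               FirstKindSemiArith G f →
               (vi vj : Fin n) → Adj G vi vj →
               AllClassesTrivial (f vi) (f vj)
mainTheorem2 n G f (_ , semi) vi vj vi~vj =
  SumInjective⇒AllClassesTrivial (f vi) (f vj)
    (either-SemiCond⇒SumInjective (f vi) (f vj) (semi vi vj vi~vj))
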